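{- Let $\Delta$ be a first-order unification context and let $\Delta'$ be obtained from $\Delta$ by applying one of the saturation rules (i.e. all premises of the rule are in $\Delta$ and $\Delta'$ is $\Delta$ together with the rule's conclusion). Then $\Delta$ and $\Delta'$ have exactly the same unifiers.
   Context: Fix constructors $c,d,e$ (with arities), unification metavariables tagged contractive ($H^{\mathrm{con}}$) or recursive ($H^{\mathrm{rec}}$), and recursion constants $\underline r,\underline s,\underline t$. Contractive terms $U ::= c\,N_1\cdots N_n\mid H^{\mathrm{con}}$; recursive terms $N ::= \underline r\mid H^{\mathrm{rec}}$; $M$ denotes either. A unification context $\Delta$ is a finite collection of equations $U_1\doteq U_2$, equations $N_1\doteq N_2$, recursive definitions $\underline r=_dU$ (at most one per constant, all constants used being defined), and possibly the symbol $\mathrm{contra}$; contradiction-free if $\mathrm{contra}\notin\Delta$. $\mathrm{defs}(\Delta)$, $\mathrm{eqs}(\Delta)$, $UV(\Delta)$ denote its definitions, equations, and unification metavariables. Expansion: $\mathrm{exp}^\Delta_0(M)=\bot$; $\mathrm{exp}^\Delta_{k+1}(H^m)=H^m$; $\mathrm{exp}^\Delta_{k+1}(c\,N_1\cdots N_n)=c\,(\mathrm{exp}^\Delta_k(N_1))\cdots(\mathrm{exp}^\Delta_k(N_n))$; $\mathrm{exp}^\Delta_{k+1}(\underline r)=\mathrm{exp}^\Delta_{k+1}(U)$ for $\underline r=_dU\in\Delta$. $M\doteq M'$ holds in $\Delta$ if $\mathrm{exp}^\Delta_k(M)=\mathrm{exp}^\Delta_k(M')$ for all $k$. A substitution $\Gamma$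 is a contradiction-free unification context whose equations have the form $H^{\mathrm{con}}\doteq U$ or $H^{\mathrm{rec}}\doteq N$, each metavariable on a left side at most once; $\mathrm{dom}(\Gamma)$ is the set of left-side metavariables. $M[\Gamma]$ replaces each $H^m\in\mathrm{dom}(\Gamma)$ by its right-hand side. $\Delta[\Gamma]=\mathrm{defs}(\Gamma)\cup\{M[\Gamma]\doteq M'[\Gamma]\mid M\doteq M'\in\mathrm{eqs}(\Delta)\}\cup\{\underline r=_dU[\Gamma]\mid \underline r=_dU\in\mathrm{defs}(\Delta)\}$ (recursion constants renamed apart as needed). A unifier of contradiction-free $\Delta$ is a substitution $\Gamma$ with $\mathrm{dom}(\Gamma)=UV(\Delta)$ such that every equation of $\Delta[\Gamma]$ holds in $\Delta[\Gamma]$; contexts containing $\mathrm{contra}$ have no unifier. Saturation rules (premises $\Rightarrow$ conclusion): SIMP-F: $c\,N_1\cdots N_n\doteq d\,N'_1\cdots N'_m$ with $c\neq d$ $\Rightarrow\mathrm{contra}$. SIMP: $c\,N_1\cdots N_n\doteq c\,N'_1\cdots N'_n\Rightarrow N_1\doteq N'_1,\dots,N_n\doteq N'_n$. R-EXP: $\underline r\doteq\underline s$, $\underline r=_dU_1$, $\underline s=_dU_2\Rightarrow U_1\doteq U_2$. U-SYM: $U\doteq U'\Rightarrow U'\doteq U$. U-TRANS: $U_1\doteq U_2$, $U_2\doteq U_3\Rightarrow U_1\doteq U_3$. N-SYM and N-TRANS: the same for recursive terms. -}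

module Defs where

open import Data.Nat using (ℕ; zero; suc)
import Data.Nat as Nat
open import Data.Vec as Vec using (Vec; []; _∷_)
open import Data.Vec.Relation.Unary.Any as VAny using ()
open import Data.List as List using (List; []; _∷_; _++_)
open import Data.List.Relation.Unary.Any as LAny using ()
open import Data.List.Membership.Propositional using (_∈_; _∉_)
open import Data.Maybe using (Maybe; just; nothing; maybe)
open import Data.Sum using (_⊎_; inj₁; inj₂)
open import Data.Sum.Properties using (≡-dec)
open import Data.Product using (_×_; _,_; Σ; ∃; ∃-syntax)
open import Relation.Binary.PropositionalEquality using (_≡_; _≢_)
open import Relation.Binary.Definitions using (DecidableEquality)
open import Relation.Nullary using (¬_; yes; no)

module Unif (Con : Set) (ar : Con → ℕ) where

  -- Syntax.  Terms are parametric in the type R of recursion constants.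
  -- Metavariables: H^con = hcon h, H^rec = hrec h  (h : ℕ).

  data RTm (R : Set) : Set where
    rc   : R → RTm R
    hrec : ℕ → RTm R

  data CTm (R : Set) : Set where
    app  : (c : Con) → Vec (RTm R) (ar c) → CTm R
    hcon : ℕ → CTm R

  data Item (R : Set) : Set where
    _≐ᵤ_   : CTm R → CTm R → Item R
    _≐ₙ_   : RTm R → RTm R → Item R
    _=d_   : R → CTm R → Item R
    contra : Item R

  -- a finite collection of items (membership is what matters)
  Ctx : Set → Set
  Ctx R = List (Item R)

  data Tag : Set where
    con rec : Tag

  MVar : Set
  MVar = Tag × ℕ

  data _occN_ {R : Set} : MVar → RTm R → Set where
    here : ∀ {h} → (rec , h) occN hrec h

  data _occC_ {R : Set} : MVar → CTm R → Set where
    here : ∀ {h} → (con , h) occC hcon h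
    arg  : ∀ {m c} {Ns : Vec (RTm R) (ar c)} →
           VAny.Any (m occN_) Ns → m occC app c Ns

  data _occI_ {R : Set} : MVar → Item R → Set where
    uˡ : ∀ {m U U'} → m occC U  → m occI (U ≐ᵤ U')
    uʳ : ∀ {m U U'} → m occC U' → m occI (U ≐ᵤ U')
    nˡ : ∀ {m N N'} → m occN N  → m occI (N ≐ₙ N')
    nʳ : ∀ {m N N'} → m occN N' → m occI (N ≐ₙ N')
    d  : ∀ {m r U}  → m occC U  → m occI (r =d U)

  UV : {R : Set} → Ctx R → MVar → Set
  UV Δ m = LAny.Any (m occI_) Δ

  data _usedN_ {R : Set} : R → RTm R → Set where
    here : ∀ {r} → r usedN rc r

  data _usedC_ {R : Set} : R → CTm R → Set where
    arg : ∀ {r c} {Ns : Vec (RTm R) (ar c)} →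
          VAny.Any (r usedN_) Ns → r usedC app c Ns

  data _usedI_ {R : Set} : R → Item R → Set where
    uˡ : ∀ {r U U'} → r usedC U  → r usedI (U ≐ᵤ U')
    uʳ : ∀ {r U U'} → r usedC U' → r usedI (U ≐ᵤ U')
    nˡ : ∀ {r N N'} → r usedN N  → r usedI (N ≐ₙ N')
    nʳ : ∀ {r N N'} → r usedN N' → r usedI (N ≐ₙ N')
    dh : ∀ {r U}    → r usedI (r =d U)
    d  : ∀ {r s U}  → r usedC U  → r usedI (s =d U)

  record UnifCtx {R : Set} (Δ : Ctx R) : Set where
    field
      defs-unique  : ∀ {r U U'} → (r =d U) ∈ Δ → (r =d U') ∈ Δ → U ≡ U'
      defs-closed  : ∀ {r} → LAny.Any (r usedI_) Δ → ∃[ U ] ((r =d U) ∈ Δ)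

  data ETm : Set where
    ⊥ₑ   : ETm
    capp : (c : Con) → Vec ETm (ar c) → ETm
    mcon : ℕ → ETm
    mrec : ℕ → ETm

  module Expansion {R : Set} (_≟_ : DecidableEquality R) (Δ : Ctx R) where

    -- the (unique, in a unification context) definition of r in Δ
    lookupDef : R → Ctx R → Maybe (CTm R)
    lookupDef r [] = nothing
    lookupDef r ((s =d U) ∷ Θ) with r ≟ s
    ... | yes _ = just U
    ... | no  _ = lookupDef r Θ
    lookupDef r (_ ∷ Θ) = lookupDef r Θ

    mutual
      -- stepC k U = exp_{k+1}(U)
      stepC : ℕ → CTm R → ETm
      stepC k (app c Ns) = capp c (expV k Ns)
      stepC k (hcon h)   = mcon h

      expN : ℕ → RTm R → ETm
      expN zero    _        = ⊥ₑ
      expN (suc k) (hrec h) = mrec h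
      expN (suc k) (rc r) with lookupDef r Δ
      ... | just U  = stepC k U
      ... | nothing = ⊥ₑ      -- impossible in a unification context

      expV : ∀ {n} → ℕ → Vec (RTm R) n → Vec ETm n
      expV k []       = []
      expV k (N ∷ Ns) = expN k N ∷ expV k Ns

    expC : ℕ → CTm R → ETm
    expC zero    _ = ⊥ₑ
    expC (suc k) U = stepC k U

    AllEqsHold : Set
    AllEqsHold =
      (∀ {U U'} → (U ≐ᵤ U') ∈ Δ → ∀ k → expC k U ≡ expC k U') ×
      (∀ {N N'} → (N ≐ₙ N') ∈ Δ → ∀ k → expN k N ≡ expN k N')

  -- Substitutions.  Recursion constants are ℕ; in Δ[Γ] the constants of
  -- Γ are renamed to inj₁ and those of Δ to inj₂ (renaming apart).

  renN : {R R' : Set} → (R → R') → RTm R → RTm R'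
  renN f (rc r)   = rc (f r)
  renN f (hrec h) = hrec h

  renC : {R R' : Set} → (R → R') → CTm R → CTm R'
  renC f (app c Ns) = app c (Vec.map (renN f) Ns)
  renC f (hcon h)   = hcon h

  record IsSubst (Γ : Ctx ℕ) : Set where
    field
      contra-free : contra ∉ Γ
      unifctx     : UnifCtx Γ
      shapeᵤ      : ∀ {U U'} → (U ≐ᵤ U') ∈ Γ → ∃[ h ] (U ≡ hcon h)
      shapeₙ      : ∀ {N N'} → (N ≐ₙ N') ∈ Γ → ∃[ h ] (N ≡ hrec h)
      uniqueᵤ     : ∀ {h U U'} → (hcon h ≐ᵤ U) ∈ Γ → (hcon h ≐ᵤ U') ∈ Γ → U ≡ U'
      uniqueₙ     : ∀ {h N N'} → (hrec h ≐ₙ N) ∈ Γ → (hrec h ≐ₙ N') ∈ Γ → N ≡ N'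

  Dom : Ctx ℕ → MVar → Set
  Dom Γ (con , h) = ∃[ U ] ((hcon h ≐ᵤ U) ∈ Γ)
  Dom Γ (rec , h) = ∃[ N ] ((hrec h ≐ₙ N) ∈ Γ)

  lookupCon : ℕ → Ctx ℕ → Maybe (CTm ℕ)
  lookupCon h [] = nothing
  lookupCon h ((hcon h' ≐ᵤ U) ∷ Γ) with h Nat.≟ h'
  ... | yes _ = just U
  ... | no  _ = lookupCon h Γ
  lookupCon h (_ ∷ Γ) = lookupCon h Γ

  lookupRec : ℕ → Ctx ℕ → Maybe (RTm ℕ)
  lookupRec h [] = nothing
  lookupRec h ((hrec h' ≐ₙ N) ∷ Γ) with h Nat.≟ h'
  ... | yes _ = just N
  ... | no  _ = lookupRec h Γ
  lookupRec h (_ ∷ Γ) = lookupRec h Γ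

  subN : Ctx ℕ → RTm ℕ → RTm (ℕ ⊎ ℕ)
  subN Γ (rc r)   = rc (inj₂ r)
  subN Γ (hrec h) = maybe (renN inj₁) (hrec h) (lookupRec h Γ)

  subC : Ctx ℕ → CTm ℕ → CTm (ℕ ⊎ ℕ)
  subC Γ (app c Ns) = app c (Vec.map (subN Γ) Ns)
  subC Γ (hcon h)   = maybe (renC inj₁) (hcon h) (lookupCon h Γ)

  defsOf : Ctx ℕ → Ctx (ℕ ⊎ ℕ)
  defsOf [] = []
  defsOf ((r =d U) ∷ Γ) = (inj₁ r =d renC inj₁ U) ∷ defsOf Γ
  defsOf (_ ∷ Γ) = defsOf Γ

  substItems : Ctx ℕ → Ctx ℕ → Ctx (ℕ ⊎ ℕ)
  substItems Γ [] = []
  substItems Γ ((U ≐ᵤ U') ∷ Δ) = (subC Γ U ≐ᵤ subC Γ U') ∷ substItems Γ Δ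
  substItems Γ ((N ≐ₙ N') ∷ Δ) = (subN Γ N ≐ₙ subN Γ N') ∷ substItems Γ Δ
  substItems Γ ((r =d U) ∷ Δ)  = (inj₂ r =d subC Γ U) ∷ substItems Γ Δ
  substItems Γ (contra ∷ Δ)    = substItems Γ Δ

  _[_] : Ctx ℕ → Ctx ℕ → Ctx (ℕ ⊎ ℕ)
  Δ [ Γ ] = defsOf Γ ++ substItems Γ Δ

  _≟⊎_ : DecidableEquality (ℕ ⊎ ℕ)
  _≟⊎_ = ≡-dec Nat._≟_ Nat._≟_

  Unifier : Ctx ℕ → Ctx ℕ → Set
  Unifier Γ Δ =
    contra ∉ Δ ×
    IsSubst Γ ×
    (∀ m → (Dom Γ m → UV Δ m) × (UV Δ m → Dom Γ m)) ×
    Expansion.AllEqsHold _≟⊎_ (Δ [ Γ ])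

  -- Saturation rules: Saturation Δ C means all premises of some rule
  -- are in Δ and C lists the rule's conclusion(s).

  data Saturation {R : Set} (Δ : Ctx R) : List (Item R) → Set where
    simp-f  : ∀ {c d} {Ns : Vec (RTm R) (ar c)} {Ns' : Vec (RTm R) (ar d)} →
              c ≢ d → (app c Ns ≐ᵤ app d Ns') ∈ Δ →
              Saturation Δ (contra ∷ [])
    simp    : ∀ {c} {Ns Ns' : Vec (RTm R) (ar c)} →
              (app c Ns ≐ᵤ app c Ns') ∈ Δ →
              Saturation Δ (Vec.toList (Vec.zipWith _≐ₙ_ Ns Ns'))
    r-exp   : ∀ {r s U₁ U₂} →
              (rc r ≐ₙ rc s) ∈ Δ → (r =d U₁) ∈ Δ → (s =d U₂) ∈ Δ →
              Saturation Δ ((U₁ ≐ᵤ U₂) ∷ [])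
    u-sym   : ∀ {U U'} → (U ≐ᵤ U') ∈ Δ → Saturation Δ ((U' ≐ᵤ U) ∷ [])
    u-trans : ∀ {U₁ U₂ U₃} → (U₁ ≐ᵤ U₂) ∈ Δ → (U₂ ≐ᵤ U₃) ∈ Δ →
              Saturation Δ ((U₁ ≐ᵤ U₃) ∷ [])
    n-sym   : ∀ {N N'} → (N ≐ₙ N') ∈ Δ → Saturation Δ ((N' ≐ₙ N) ∷ [])
    n-trans : ∀ {N₁ N₂ N₃} → (N₁ ≐ₙ N₂) ∈ Δ → (N₂ ≐ₙ N₃) ∈ Δ →
              Saturation Δ ((N₁ ≐ₙ N₃) ∷ [])

{-# OPTIONS --safe #-}
module Submission where

-- A saturation rule only adds consequences of Δ, so adding them changes none of the four
-- components of being a unifier.  No rule concludes a definition, hence Δ[Γ] and (C ++ Δ)[Γ]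
-- define the same recursion constants and expand every term identically.  Each substituted
-- conclusion holds in Δ[Γ] once the substituted premises do: SIMP and SIMP-F because an
-- expansion of c N₁ ⋯ Nₙ one level deeper is c applied to the expansions of the Nᵢ, R-EXP by
-- unfolding one expansion step of r and s, the symmetry and transitivity rules trivially.
-- Finally a conclusion mentions only metavariables of its premises, so UV is unchanged.

open import Defs
open import Data.Nat as Nat using (ℕ; zero; suc)
open import Data.Vec as Vec using (Vec; []; _∷_)
open import Data.Vec.Relation.Unary.Any as VAny using ()
open import Data.List using (List; []; _∷_; _++_)
open import Data.List.Relation.Unary.Any as Any using (Any; here; there)
open import Data.List.Relation.Unary.All as All using (All; []; _∷_)
import Data.List.Relation.Unary.Any.Properties as Anyₚ
import Data.List.Relation.Unary.All.Properties as Allₚ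
open import Data.List.Membership.Propositional using (_∈_; _∉_)
open import Data.List.Membership.Propositional.Properties using (∈-++⁺ʳ; ∈-++⁻; ∈-∃++)
open import Data.Maybe as Maybe using (Maybe; just; nothing; _<∣>_)
open import Data.Sum using (_⊎_; inj₁; inj₂; [_,_])
open import Data.Product using (_×_; _,_; proj₁; proj₂)
open import Data.Unit using (⊤; tt)
open import Data.Empty using (⊥-elim)
open import Function using (_∘_; id)
open import Relation.Binary.Definitions using (DecidableEquality)
open import Relation.Binary.PropositionalEquality hiding ([_])
open import Relation.Nullary using (yes; no)

module _ {Con : Set} {ar : Con → ℕ} where
  open Unif Con ar

  module _ {R : Set} (_≟_ : DecidableEquality R) where
    private
      module E (Θ : Ctx R) = Expansion _≟_ Θ

    -- lookupDef never consults the module parameter of Expansion, but only propositionally.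
    lookupDef-irrelevant : ∀ Θ Θ' r L → E.lookupDef Θ r L ≡ E.lookupDef Θ' r L
    lookupDef-irrelevant Θ Θ' r [] = refl
    lookupDef-irrelevant Θ Θ' r ((_ ≐ᵤ _) ∷ L) = lookupDef-irrelevant Θ Θ' r L
    lookupDef-irrelevant Θ Θ' r ((_ ≐ₙ _) ∷ L) = lookupDef-irrelevant Θ Θ' r L
    lookupDef-irrelevant Θ Θ' r (contra ∷ L) = lookupDef-irrelevant Θ Θ' r L
    lookupDef-irrelevant Θ Θ' r ((s =d U) ∷ L) with r ≟ s
    ... | yes _ = refl
    ... | no  _ = lookupDef-irrelevant Θ Θ' r L

    lookupDef-++ : ∀ Θ r P X → E.lookupDef Θ r (P ++ X) ≡ E.lookupDef Θ r P <∣> E.lookupDef Θ r X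
    lookupDef-++ Θ r [] X = refl
    lookupDef-++ Θ r ((_ ≐ᵤ _) ∷ P) X = lookupDef-++ Θ r P X
    lookupDef-++ Θ r ((_ ≐ₙ _) ∷ P) X = lookupDef-++ Θ r P X
    lookupDef-++ Θ r (contra ∷ P) X = lookupDef-++ Θ r P X
    lookupDef-++ Θ r ((s =d U) ∷ P) X with r ≟ s
    ... | yes _ = refl
    ... | no  _ = lookupDef-++ Θ r P X

    lookupDef-++-undefined : ∀ Θ r P {A} X → E.lookupDef Θ r A ≡ nothing →
                             E.lookupDef Θ r (P ++ A ++ X) ≡ E.lookupDef Θ r (P ++ X)
    lookupDef-++-undefined Θ r P {A} X undefined = begin
      E.lookupDef Θ r (P ++ A ++ X)                   ≡⟨ lookupDef-++ Θ r P (A ++ X) ⟩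
      lookup P <∣> E.lookupDef Θ r (A ++ X)          ≡⟨ cong (lookup P <∣>_) (lookupDef-++ Θ r A X) ⟩
      lookup P <∣> (E.lookupDef Θ r A <∣> lookup X)  ≡⟨ cong (λ a → lookup P <∣> (a <∣> lookup X)) undefined ⟩
      lookup P <∣> lookup X                           ≡⟨ lookupDef-++ Θ r P X ⟨
      E.lookupDef Θ r (P ++ X)                        ∎
      where
      open ≡-Reasoning
      lookup : Ctx R → Maybe (CTm R)
      lookup = E.lookupDef Θ r

    lookupDef-∈ : ∀ Θ {r U L} → (∀ {U'} → (r =d U') ∈ L → U' ≡ U) →
                  (r =d U) ∈ L → E.lookupDef Θ r L ≡ just U
    lookupDef-∈ Θ {L = (_ ≐ᵤ _) ∷ L} unique (there p) = lookupDef-∈ Θ (unique ∘ there) p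
    lookupDef-∈ Θ {L = (_ ≐ₙ _) ∷ L} unique (there p) = lookupDef-∈ Θ (unique ∘ there) p
    lookupDef-∈ Θ {L = contra ∷ L} unique (there p) = lookupDef-∈ Θ (unique ∘ there) p
    lookupDef-∈ Θ {r} {L = (s =d V) ∷ L} unique p with r ≟ s
    ... | yes refl = cong just (unique (here refl))
    lookupDef-∈ Θ {L = (s =d V) ∷ L} unique (here refl) | no r≢s = ⊥-elim (r≢s refl)
    lookupDef-∈ Θ {L = (s =d V) ∷ L} unique (there p)   | no _   = lookupDef-∈ Θ (unique ∘ there) p

    module _ (Θ : Ctx R) where
      open Expansion _≟_ Θ

      expN-rc : ∀ {k r U} → lookupDef r Θ ≡ just U → expN (suc k) (rc r) ≡ stepC k U
      expN-rc eq rewrite eq = refl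

      Holds : Item R → Set
      Holds (U ≐ᵤ U') = ∀ k → expC k U ≡ expC k U'
      Holds (N ≐ₙ N') = ∀ k → expN k N ≡ expN k N'
      Holds (_ =d _)  = ⊤
      Holds contra    = ⊤

      AllEqsHold⇒All-Holds : AllEqsHold → All Holds Θ
      AllEqsHold⇒All-Holds (holdsᵤ , holdsₙ) = All.tabulate holds
        where
        holds : ∀ {x} → x ∈ Θ → Holds x
        holds {_ ≐ᵤ _} p = holdsᵤ p
        holds {_ ≐ₙ _} p = holdsₙ p
        holds {_ =d _} _ = tt
        holds {contra} _ = tt

      All-Holds⇒AllEqsHold : All Holds Θ → AllEqsHold
      All-Holds⇒AllEqsHold h = All.lookup h , All.lookup h

    module _ (Θ₁ Θ₂ : Ctx R) (same-defs : ∀ r → E.lookupDef Θ₁ r Θ₁ ≡ E.lookupDef Θ₂ r Θ₂) where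
      private
        module E₁ = Expansion _≟_ Θ₁
        module E₂ = Expansion _≟_ Θ₂

      mutual
        stepC-cong : ∀ k U → E₁.stepC k U ≡ E₂.stepC k U
        stepC-cong k (app c Ns) = cong (capp c) (expV-cong k Ns)
        stepC-cong k (hcon h)   = refl

        expN-cong : ∀ k N → E₁.expN k N ≡ E₂.expN k N
        expN-cong zero    N        = refl
        expN-cong (suc k) (hrec h) = refl
        expN-cong (suc k) (rc r) with E₁.lookupDef r Θ₁ | E₂.lookupDef r Θ₂ | same-defs r
        ... | just U  | _ | refl = stepC-cong k U
        ... | nothing | _ | refl = refl

        expV-cong : ∀ {n} k (Ns : Vec (RTm R) n) → E₁.expV k Ns ≡ E₂.expV k Ns
        expV-cong k []       = refl
        expV-cong k (N ∷ Ns) = cong₂ _∷_ (expN-cong k N) (expV-cong k Ns)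

      expC-cong : ∀ k U → E₁.expC k U ≡ E₂.expC k U
      expC-cong zero    U = refl
      expC-cong (suc k) U = stepC-cong k U

      Holds-cong : ∀ {x} → Holds Θ₁ x → Holds Θ₂ x
      Holds-cong {U ≐ᵤ U'} h k = trans (sym (expC-cong k U)) (trans (h k) (expC-cong k U'))
      Holds-cong {N ≐ₙ N'} h k = trans (sym (expN-cong k N)) (trans (h k) (expN-cong k N'))
      Holds-cong {_ =d _}  _   = tt
      Holds-cong {contra}  _   = tt

  private
    module E⊎ (Θ : Ctx (ℕ ⊎ ℕ)) = Expansion _≟⊎_ Θ
    module Eℕ (Θ : Ctx ℕ) = Expansion Nat._≟_ Θ

  substItems-++ : ∀ Γ (A B : Ctx ℕ) → substItems Γ (A ++ B) ≡ substItems Γ A ++ substItems Γ B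
  substItems-++ Γ [] B = refl
  substItems-++ Γ ((_ ≐ᵤ _) ∷ A) B = cong (_ ∷_) (substItems-++ Γ A B)
  substItems-++ Γ ((_ ≐ₙ _) ∷ A) B = cong (_ ∷_) (substItems-++ Γ A B)
  substItems-++ Γ ((_ =d _) ∷ A) B = cong (_ ∷_) (substItems-++ Γ A B)
  substItems-++ Γ (contra ∷ A) B   = substItems-++ Γ A B

  All-substItems-∈ : ∀ {P : Item (ℕ ⊎ ℕ) → Set} Γ {x L} → x ∈ L →
                     All P (substItems Γ L) → All P (substItems Γ (x ∷ []))
  All-substItems-∈ {P} Γ {x} x∈L all with ∈-∃++ x∈L
  ... | A , B , refl = Allₚ.++⁻ˡ (substItems Γ (x ∷ []))
    (subst (All P) (substItems-++ Γ (x ∷ []) B)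
      (Allₚ.++⁻ʳ (substItems Γ A) (subst (All P) (substItems-++ Γ A (x ∷ B)) all)))

  lookupDef-defsOf : ∀ Θ Γ r → E⊎.lookupDef Θ (inj₂ r) (defsOf Γ) ≡ nothing
  lookupDef-defsOf Θ [] r = refl
  lookupDef-defsOf Θ ((_ ≐ᵤ _) ∷ Γ) r = lookupDef-defsOf Θ Γ r
  lookupDef-defsOf Θ ((_ ≐ₙ _) ∷ Γ) r = lookupDef-defsOf Θ Γ r
  lookupDef-defsOf Θ (contra ∷ Γ) r = lookupDef-defsOf Θ Γ r
  lookupDef-defsOf Θ ((s =d _) ∷ Γ) r with inj₂ r ≟⊎ inj₁ s
  ... | yes ()
  ... | no _ = lookupDef-defsOf Θ Γ r

  lookupDef-substItems : ∀ Θ Θ₀ Γ r L →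
    E⊎.lookupDef Θ (inj₂ r) (substItems Γ L) ≡ Maybe.map (subC Γ) (Eℕ.lookupDef Θ₀ r L)
  lookupDef-substItems Θ Θ₀ Γ r [] = refl
  lookupDef-substItems Θ Θ₀ Γ r ((_ ≐ᵤ _) ∷ L) = lookupDef-substItems Θ Θ₀ Γ r L
  lookupDef-substItems Θ Θ₀ Γ r ((_ ≐ₙ _) ∷ L) = lookupDef-substItems Θ Θ₀ Γ r L
  lookupDef-substItems Θ Θ₀ Γ r (contra ∷ L) = lookupDef-substItems Θ Θ₀ Γ r L
  lookupDef-substItems Θ Θ₀ Γ r ((s =d _) ∷ L) with inj₂ r ≟⊎ inj₂ s | r Nat.≟ s
  ... | yes refl | yes _   = refl
  ... | yes refl | no r≢r  = ⊥-elim (r≢r refl)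
  ... | no r≢s   | yes refl = ⊥-elim (r≢s refl)
  ... | no _     | no _    = lookupDef-substItems Θ Θ₀ Γ r L

  lookupDef-inj₂ : ∀ {Δ r U} → UnifCtx Δ → (r =d U) ∈ Δ → ∀ Γ →
                   E⊎.lookupDef (Δ [ Γ ]) (inj₂ r) (Δ [ Γ ]) ≡ just (subC Γ U)
  lookupDef-inj₂ {Δ} {r} {U} unifCtx r=U Γ = begin
    lookup (defsOf Γ ++ substItems Γ Δ)                  ≡⟨ lookupDef-++ _≟⊎_ Θ (inj₂ r) (defsOf Γ) _ ⟩
    lookup (defsOf Γ) <∣> lookup (substItems Γ Δ)         ≡⟨ cong (_<∣> lookup (substItems Γ Δ)) (lookupDef-defsOf Θ Γ r) ⟩
    lookup (substItems Γ Δ)                              ≡⟨ lookupDef-substItems Θ Δ Γ r Δ ⟩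
    Maybe.map (subC Γ) (Eℕ.lookupDef Δ r Δ)               ≡⟨ cong (Maybe.map (subC Γ)) r-defined ⟩
    just (subC Γ U)                                      ∎
    where
    open ≡-Reasoning
    Θ : Ctx (ℕ ⊎ ℕ)
    Θ = Δ [ Γ ]
    lookup : Ctx (ℕ ⊎ ℕ) → Maybe (CTm (ℕ ⊎ ℕ))
    lookup = E⊎.lookupDef Θ (inj₂ r)
    r-defined : Eℕ.lookupDef Δ r Δ ≡ just U
    r-defined = lookupDef-∈ Nat._≟_ Δ (λ r=U' → UnifCtx.defs-unique unifCtx r=U' r=U) r=U

  zip-undefined : ∀ Θ Γ r {n} (Ns Ns' : Vec (RTm ℕ) n) →
    E⊎.lookupDef Θ r (substItems Γ (Vec.toList (Vec.zipWith _≐ₙ_ Ns Ns'))) ≡ nothing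
  zip-undefined Θ Γ r []       []         = refl
  zip-undefined Θ Γ r (_ ∷ Ns) (_ ∷ Ns') = zip-undefined Θ Γ r Ns Ns'

  conclusions-undefined : ∀ {Δ C} → Saturation Δ C → ∀ Θ Γ r →
                          E⊎.lookupDef Θ r (substItems Γ C) ≡ nothing
  conclusions-undefined (simp-f _ _) Θ Γ r = refl
  conclusions-undefined (simp {Ns = Ns} {Ns'} _) Θ Γ r = zip-undefined Θ Γ r Ns Ns'
  conclusions-undefined (r-exp _ _ _) Θ Γ r = refl
  conclusions-undefined (u-sym _) Θ Γ r = refl
  conclusions-undefined (u-trans _ _) Θ Γ r = refl
  conclusions-undefined (n-sym _) Θ Γ r = refl
  conclusions-undefined (n-trans _ _) Θ Γ r = refl

  same-defs-conclusions : ∀ {Δ C} → Saturation Δ C → ∀ Γ r →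
    E⊎.lookupDef ((C ++ Δ) [ Γ ]) r ((C ++ Δ) [ Γ ]) ≡ E⊎.lookupDef (Δ [ Γ ]) r (Δ [ Γ ])
  same-defs-conclusions {Δ} {C} sat Γ r = begin
    E⊎.lookupDef Θ' r (defsOf Γ ++ substItems Γ (C ++ Δ))
      ≡⟨ cong (λ L → E⊎.lookupDef Θ' r (defsOf Γ ++ L)) (substItems-++ Γ C Δ) ⟩
    E⊎.lookupDef Θ' r (defsOf Γ ++ substItems Γ C ++ substItems Γ Δ)
      ≡⟨ lookupDef-++-undefined _≟⊎_ Θ' r (defsOf Γ) _ (conclusions-undefined sat Θ' Γ r) ⟩
    E⊎.lookupDef Θ' r (Δ [ Γ ])
      ≡⟨ lookupDef-irrelevant _≟⊎_ Θ' (Δ [ Γ ]) r (Δ [ Γ ]) ⟩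
    E⊎.lookupDef (Δ [ Γ ]) r (Δ [ Γ ])
      ∎
    where
    open ≡-Reasoning
    Θ' : Ctx (ℕ ⊎ ℕ)
    Θ' = (C ++ Δ) [ Γ ]

  occI-∈⇒UV : ∀ {Δ : Ctx ℕ} {x m} → x ∈ Δ → m occI x → UV Δ m
  occI-∈⇒UV x∈Δ o = Any.map (λ eq → subst (_ occI_) eq o) x∈Δ

  occI-zip⁻ : ∀ {n m} (Ns Ns' : Vec (RTm ℕ) n) →
              Any (m occI_) (Vec.toList (Vec.zipWith _≐ₙ_ Ns Ns')) →
              VAny.Any (m occN_) Ns ⊎ VAny.Any (m occN_) Ns'
  occI-zip⁻ []       []         ()
  occI-zip⁻ (_ ∷ _)  (_ ∷ _)   (here (nˡ o)) = inj₁ (VAny.here o)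
  occI-zip⁻ (_ ∷ _)  (_ ∷ _)   (here (nʳ o)) = inj₂ (VAny.here o)
  occI-zip⁻ (_ ∷ Ns) (_ ∷ Ns') (there p) with occI-zip⁻ Ns Ns' p
  ... | inj₁ o = inj₁ (VAny.there o)
  ... | inj₂ o = inj₂ (VAny.there o)

  UV-conclusions : ∀ {Δ C : Ctx ℕ} {m} → Saturation Δ C → Any (m occI_) C → UV Δ m
  UV-conclusions (simp-f _ _) (here ())
  UV-conclusions (simp {Ns = Ns} {Ns'} p) o with occI-zip⁻ Ns Ns' o
  ... | inj₁ o' = occI-∈⇒UV p (uˡ (arg o'))
  ... | inj₂ o' = occI-∈⇒UV p (uʳ (arg o'))
  UV-conclusions (r-exp _ r=U s=U) (here (uˡ o)) = occI-∈⇒UV r=U (d o)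
  UV-conclusions (r-exp _ r=U s=U) (here (uʳ o)) = occI-∈⇒UV s=U (d o)
  UV-conclusions (u-sym p)       (here (uˡ o)) = occI-∈⇒UV p (uʳ o)
  UV-conclusions (u-sym p)       (here (uʳ o)) = occI-∈⇒UV p (uˡ o)
  UV-conclusions (u-trans p _)   (here (uˡ o)) = occI-∈⇒UV p (uˡ o)
  UV-conclusions (u-trans _ q)   (here (uʳ o)) = occI-∈⇒UV q (uʳ o)
  UV-conclusions (n-sym p)       (here (nˡ o)) = occI-∈⇒UV p (nʳ o)
  UV-conclusions (n-sym p)       (here (nʳ o)) = occI-∈⇒UV p (nˡ o)
  UV-conclusions (n-trans p _)   (here (nˡ o)) = occI-∈⇒UV p (nˡ o)
  UV-conclusions (n-trans _ q)   (here (nʳ o)) = occI-∈⇒UV q (nʳ o)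

  capp-injectiveˡ : ∀ {c d} {v : Vec ETm (ar c)} {w : Vec ETm (ar d)} → capp c v ≡ capp d w → c ≡ d
  capp-injectiveˡ refl = refl

  capp-injectiveʳ : ∀ {c} {v w : Vec ETm (ar c)} → capp c v ≡ capp c w → v ≡ w
  capp-injectiveʳ refl = refl

  module Soundness {Δ : Ctx ℕ} (unifCtx : UnifCtx Δ) (Γ : Ctx ℕ)
                   (holds : All (Holds _≟⊎_ (Δ [ Γ ])) (Δ [ Γ ])) where
    private
      Θ : Ctx (ℕ ⊎ ℕ)
      Θ = Δ [ Γ ]
      open Expansion _≟⊎_ Θ

    substituted-holds : ∀ {x} → x ∈ Δ → All (Holds _≟⊎_ Θ) (substItems Γ (x ∷ []))
    substituted-holds x∈Δ = All-substItems-∈ Γ x∈Δ (Allₚ.++⁻ʳ (defsOf Γ) holds)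

    holdsᵤ : ∀ {U U'} → (U ≐ᵤ U') ∈ Δ → ∀ k → expC k (subC Γ U) ≡ expC k (subC Γ U')
    holdsᵤ p = All.head (substituted-holds p)

    holdsₙ : ∀ {N N'} → (N ≐ₙ N') ∈ Δ → ∀ k → expN k (subN Γ N) ≡ expN k (subN Γ N')
    holdsₙ p = All.head (substituted-holds p)

    zip-holds : ∀ {n} (Ns Ns' : Vec (RTm ℕ) n) →
                (∀ k → expV k (Vec.map (subN Γ) Ns) ≡ expV k (Vec.map (subN Γ) Ns')) →
                All (Holds _≟⊎_ Θ) (substItems Γ (Vec.toList (Vec.zipWith _≐ₙ_ Ns Ns')))
    zip-holds []       []         _  = []
    zip-holds (_ ∷ Ns) (_ ∷ Ns') eq =
      (λ k → cong Vec.head (eq k)) ∷ zip-holds Ns Ns' (λ k → cong Vec.tail (eq k))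

    r-exp-holds : ∀ {r s U₁ U₂} → (rc r ≐ₙ rc s) ∈ Δ → (r =d U₁) ∈ Δ → (s =d U₂) ∈ Δ →
                  ∀ k → expC k (subC Γ U₁) ≡ expC k (subC Γ U₂)
    r-exp-holds rs r=U₁ s=U₂ zero    = refl
    r-exp-holds {r} {s} {U₁} {U₂} rs r=U₁ s=U₂ (suc k) = begin
      stepC k (subC Γ U₁)         ≡⟨ expN-rc _≟⊎_ Θ (lookupDef-inj₂ unifCtx r=U₁ Γ) ⟨
      expN (suc k) (rc (inj₂ r))  ≡⟨ holdsₙ rs (suc k) ⟩
      expN (suc k) (rc (inj₂ s))  ≡⟨ expN-rc _≟⊎_ Θ (lookupDef-inj₂ unifCtx s=U₂ Γ) ⟩
      stepC k (subC Γ U₂)         ∎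
      where open ≡-Reasoning

    conclusions-hold : ∀ {C} → Saturation Δ C → All (Holds _≟⊎_ Θ) (substItems Γ C)
    conclusions-hold (simp-f _ _)               = []
    conclusions-hold (simp {Ns = Ns} {Ns'} p)   =
      zip-holds Ns Ns' (λ k → capp-injectiveʳ (holdsᵤ p (suc k)))
    conclusions-hold (r-exp rs r=U₁ s=U₂)       = r-exp-holds rs r=U₁ s=U₂ ∷ []
    conclusions-hold (u-sym p)                  = (λ k → sym (holdsᵤ p k)) ∷ []
    conclusions-hold (u-trans p q)              = (λ k → trans (holdsᵤ p k) (holdsᵤ q k)) ∷ []
    conclusions-hold (n-sym p)                  = (λ k → sym (holdsₙ p k)) ∷ []
    conclusions-hold (n-trans p q)              = (λ k → trans (holdsₙ p k) (holdsₙ q k)) ∷ []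

    zip-contra-free : ∀ {n} (Ns Ns' : Vec (RTm ℕ) n) → contra ∉ Vec.toList (Vec.zipWith _≐ₙ_ Ns Ns')
    zip-contra-free []       []         ()
    zip-contra-free (_ ∷ Ns) (_ ∷ Ns') (there p) = zip-contra-free Ns Ns' p

    conclusions-contra-free : ∀ {C} → Saturation Δ C → contra ∉ C
    conclusions-contra-free (simp-f c≢d p) _ = c≢d (capp-injectiveˡ (holdsᵤ p 1))
    conclusions-contra-free (simp {Ns = Ns} {Ns'} _) = zip-contra-free Ns Ns'
    conclusions-contra-free (r-exp _ _ _) (here ())
    conclusions-contra-free (u-sym _)     (here ())
    conclusions-contra-free (u-trans _ _) (here ())
    conclusions-contra-free (n-sym _)     (here ())
    conclusions-contra-free (n-trans _ _) (here ())

  module _ {Δ C : Ctx ℕ} (sat : Saturation Δ C) (Γ : Ctx ℕ) where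
    private
      Θ Θ' : Ctx (ℕ ⊎ ℕ)
      Θ  = Δ [ Γ ]
      Θ' = (C ++ Δ) [ Γ ]

      Θ'-split : Θ' ≡ defsOf Γ ++ substItems Γ C ++ substItems Γ Δ
      Θ'-split = cong (defsOf Γ ++_) (substItems-++ Γ C Δ)

    All-insert-conclusions : ∀ {P : Item (ℕ ⊎ ℕ) → Set} → All P Θ → All P (substItems Γ C) → All P Θ'
    All-insert-conclusions {P} h c = subst (All P) (sym Θ'-split)
      (Allₚ.++⁺ (Allₚ.++⁻ˡ (defsOf Γ) h) (Allₚ.++⁺ c (Allₚ.++⁻ʳ (defsOf Γ) h)))

    All-drop-conclusions : ∀ {P : Item (ℕ ⊎ ℕ) → Set} → All P Θ' → All P Θ
    All-drop-conclusions {P} h' =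
      Allₚ.++⁺ (Allₚ.++⁻ˡ (defsOf Γ) h) (Allₚ.++⁻ʳ (substItems Γ C) (Allₚ.++⁻ʳ (defsOf Γ) h))
      where
      h : All P (defsOf Γ ++ substItems Γ C ++ substItems Γ Δ)
      h = subst (All P) Θ'-split h'

    UV-++⁻ : ∀ {m} → UV (C ++ Δ) m → UV Δ m
    UV-++⁻ u = [ UV-conclusions sat , id ] (Anyₚ.++⁻ C u)

    unifier-extend : UnifCtx Δ → Unifier Γ Δ → Unifier Γ (C ++ Δ)
    unifier-extend unifCtx (contra∉Δ , isSubst , dom , eqs) =
      [ conclusions-contra-free sat , contra∉Δ ] ∘ ∈-++⁻ C ,
      isSubst ,
      (λ m → UV-++⁺ʳ ∘ proj₁ (dom m) , proj₂ (dom m) ∘ UV-++⁻) ,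
      All-Holds⇒AllEqsHold _≟⊎_ Θ'
        (All.map (Holds-cong _≟⊎_ Θ Θ' (sym ∘ same-defs-conclusions sat Γ))
                 (All-insert-conclusions holds (conclusions-hold sat)))
      where
      holds : All (Holds _≟⊎_ Θ) Θ
      holds = AllEqsHold⇒All-Holds _≟⊎_ Θ eqs
      open Soundness unifCtx Γ holds
      UV-++⁺ʳ : ∀ {m} → UV Δ m → UV (C ++ Δ) m
      UV-++⁺ʳ = Anyₚ.++⁺ʳ C

    unifier-restrict : Unifier Γ (C ++ Δ) → Unifier Γ Δ
    unifier-restrict (contra∉C++Δ , isSubst , dom , eqs) =
      contra∉C++Δ ∘ ∈-++⁺ʳ C ,
      isSubst ,
      (λ m → UV-++⁻ ∘ proj₁ (dom m) , proj₂ (dom m) ∘ Anyₚ.++⁺ʳ C) ,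
      All-Holds⇒AllEqsHold _≟⊎_ Θ
        (All.map (Holds-cong _≟⊎_ Θ' Θ (same-defs-conclusions sat Γ))
                 (All-drop-conclusions (AllEqsHold⇒All-Holds _≟⊎_ Θ' eqs)))

theorem2p5 : (Con : Set) (ar : Con → ℕ) →
    let open Unif Con ar in
    (Δ : Ctx ℕ) → UnifCtx Δ →
    (C : List (Item ℕ)) → Saturation Δ C →
    (Γ : Ctx ℕ) →
    (Unifier Γ Δ → Unifier Γ (C ++ Δ)) × (Unifier Γ (C ++ Δ) → Unifier Γ Δ)
theorem2p5 Con ar Δ unifCtx C sat Γ = unifier-extend sat Γ unifCtx , unifier-restrict sat Γ
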